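{- For any degenerate class of graphs $\mathcal{F}$, there exists a constant $c_{\mathcal{F}}$ such that the following holds. Let $G$ be a graph in $\mathcal{F}$, together with a $\Sigma$-system such that $\Sigma(u)\cap\Sigma(v)=\varnothing$ for every two distinct vertices $u,v$. Then $\mathit{ch}(G;\Sigma)\le\Delta(G;\Sigma)+c_{\mathcal{F}}$.
   Context: Graphs are finite and simple. A graph is $q$-degenerate if there is an ordering $v_1,\dots,v_n$ of its vertices such that each $v_i$ has at most $q$ neighbours in $\{v_1,\dots,v_{i-1}\}$; a class of graphs is degenerate if there is some $q$ such that every graph in the class is $q$-degenerate. A $\Sigma$-system for $G=(V,E)$ is a choice of subsets $\Sigma(v)\subseteq N(v)$ for each $v\in V$. A $\Sigma$-colouring is a vertex colouring in which adjacent vertices get different colours and any two distinct vertices belonging to a common $\Sigma(t)$ get different colours. $\Delta(G;\Sigma)=\max_v|\Sigma(v)|$, and $\mathit{ch}(G;\Sigma)$ is the minimum $k$ such that for every assignment of lists of at least $k$ colours to the vertices there is a $\Sigma$-colouring with each vertex coloured from its own list. -}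

module Defs where

open import Data.Nat using (ℕ; _≤_; _⊔_)
open import Data.Fin using (Fin; _<?_)
open import Data.Fin.Permutation using (Permutation′; _⟨$⟩ʳ_)
open import Data.Bool using (Bool; true; false; _∧_)
open import Data.List using (List; length; filterᵇ; map; foldr; allFin)
open import Data.List.Membership.Propositional using (_∈_)
open import Data.List.Relation.Unary.Unique.Propositional using (Unique)
open import Relation.Binary.PropositionalEquality using (_≡_; _≢_)
open import Relation.Nullary.Decidable using (⌊_⌋)
open import Data.Product using (Σ; _×_)

record Graph (n : ℕ) : Set where
  field
    adj    : Fin n → Fin n → Bool
    adj-sym    : ∀ u v → adj u v ≡ true → adj v u ≡ true
    adj-irrefl : ∀ v → adj v v ≡ false
open Graph public

count : ∀ {n} → (Fin n → Bool) → ℕ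
count {n} p = length (filterᵇ p (allFin n))

-- G is q-degenerate: there is an ordering v_0, …, v_{n-1} (a permutation σ
-- of Fin n, v_i = σ i) such that each v_i has at most q neighbours among
-- v_0, …, v_{i-1}.
Degenerate : ∀ {n} → ℕ → Graph n → Set
Degenerate {n} q G =
  Σ (Permutation′ n) λ σ →
    ∀ (i : Fin n) →
      count (λ j → ⌊ j <? i ⌋ ∧ adj G (σ ⟨$⟩ʳ i) (σ ⟨$⟩ʳ j)) ≤ q

GraphClass : Set₁
GraphClass = ∀ (n : ℕ) → Graph n → Set

DegenerateClass : GraphClass → Set
DegenerateClass 𝓕 =
  Σ ℕ λ q → ∀ (n : ℕ) (G : Graph n) → 𝓕 n G → Degenerate q G

-- A Σ-system: Sys v u = true means u ∈ Σ(v); required Σ(v) ⊆ N(v).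
record SigmaSystem {n : ℕ} (G : Graph n) : Set where
  field
    mem   : Fin n → Fin n → Bool
    mem⊆N : ∀ v u → mem v u ≡ true → adj G v u ≡ true
open SigmaSystem public

PairwiseDisjoint : ∀ {n} {G : Graph n} → SigmaSystem G → Set
PairwiseDisjoint {n} S =
  ∀ (u v w : Fin n) → u ≢ v → mem S u w ≡ true → mem S v w ≡ false

ΔΣ : ∀ {n} {G : Graph n} → SigmaSystem G → ℕ
ΔΣ {n} S = foldr _⊔_ 0 (map (λ v → count (mem S v)) (allFin n))

IsΣColouring : ∀ {n} {G : Graph n} → SigmaSystem G → (Fin n → ℕ) → Set
IsΣColouring {n} {G} S c =
  (∀ (u v : Fin n) → adj G u v ≡ true → c u ≢ c v) ×
  (∀ (t u v : Fin n) → u ≢ v → mem S t u ≡ true → mem S t v ≡ true → c u ≢ c v)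

-- ch(G;Σ) ≤ k : every assignment of lists of at least k (distinct) colours
-- admits a Σ-colouring from the lists.  (Since list-colourability is
-- monotone in k, this is exactly "the minimum such k is ≤ k".)
ChooseΣ≤ : ∀ {n} {G : Graph n} → SigmaSystem G → ℕ → Set
ChooseΣ≤ {n} S k =
  ∀ (L : Fin n → List ℕ) →
    (∀ v → Unique (L v)) →
    (∀ v → k ≤ length (L v)) →
    Σ (Fin n → ℕ) λ c → (∀ v → c v ∈ L v) × IsΣColouring S c

-- Colour greedily along a degeneracy ordering. When a vertex x is reached,
-- its colour must avoid the colours of its at most q earlier neighbours and
-- of its Σ-partners, i.e. the other members of the sets Σ(t) containing x.
-- Since the sets Σ(t) are pairwise disjoint, x lies in at most one of them,
-- so it has at most Δ(G;Σ) Σ-partners. Lists of Δ(G;Σ) + q + 1 colours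
-- therefore always leave a free colour.
module Submission where

open import Defs
open import Data.Nat using (ℕ; suc; _+_; _≤_; _<_; _⊔_; z≤n; s≤s⁻¹; _≟_)
open import Data.Nat.Properties
  using (≤-trans; ≤-reflexive; m≤m⊔n; m≤n⊔m; <⇒≤; <-irrefl; n<1+n; +-mono-≤; +-suc; +-comm;
         m<1+n⇒m<n∨m≡n; module ≤-Reasoning)
open import Data.Fin as Fin using (Fin; toℕ; fromℕ<; _<?_)
open import Data.Fin.Properties using (toℕ-injective; toℕ-fromℕ<; toℕ<n; any?)
open import Data.Fin.Permutation using (Permutation′; _⟨$⟩ʳ_; _⟨$⟩ˡ_; inverseʳ; inverseˡ)
open import Data.Bool using (Bool; true; T?; _∧_)
open import Data.Bool.Properties using (T-≡) renaming (_≟_ to _≟ᵇ_)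
open import Data.List using (List; []; _∷_; length; filterᵇ; map; foldr; allFin; _++_)
open import Data.List.Properties using (length-map; length-++; length-removeAt′)
open import Data.List.Membership.Propositional using (_∈_; _∉_; _─_)
open import Data.List.Membership.Propositional.Properties
  using (∈-filter⁺; ∈-allFin; ∈-map⁺; ∈-++⁺ˡ; ∈-++⁺ʳ)
import Data.List.Membership.DecPropositional as DecMembership
open import Data.List.Relation.Unary.Any using (here; there; index)
open import Data.List.Relation.Unary.All using (lookup)
open import Data.List.Relation.Unary.Unique.Propositional using (Unique; _∷_)
open import Data.Vec.Functional using (updateAt)
open import Data.Vec.Functional.Properties using (updateAt-updates; updateAt-minimal)
open import Data.Product using (Σ; ∃-syntax; _×_; _,_; proj₁; proj₂)
open import Data.Sum using (_⊎_; inj₁; inj₂)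
open import Data.Empty using (⊥-elim)
open import Function using (_∘_; const; Equivalence)
open import Level using (0ℓ)
open import Relation.Binary.Core using (Rel)
open import Relation.Binary.Definitions using (Symmetric; DecidableEquality)
open import Relation.Binary.PropositionalEquality
  using (_≡_; _≢_; refl; sym; trans; cong; cong₂; subst; subst₂)
open import Relation.Nullary using (yes; no)
open import Relation.Nullary.Decidable using (⌊_⌋; fromWitness)

module _ {A : Set} where

  ∈-─⁺ : ∀ {x y : A} {ys} (x∈ys : x ∈ ys) → y ∈ ys → y ≢ x → y ∈ ys ─ x∈ys
  ∈-─⁺ (here refl) (here refl) y≢x = ⊥-elim (y≢x refl)
  ∈-─⁺ (here _)    (there y∈)  _   = y∈
  ∈-─⁺ (there _)   (here refl) _   = here refl
  ∈-─⁺ (there x∈)  (there y∈)  y≢x = there (∈-─⁺ x∈ y∈ y≢x)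

  ∃∉-of-shorter : DecidableEquality A → ∀ {xs ys : List A} →
                  Unique xs → length ys < length xs → ∃[ z ] z ∈ xs × z ∉ ys
  ∃∉-of-shorter _≟_ {x ∷ xs} {ys} (x≢xs ∷ xs-unique) ys<x∷xs with DecMembership._∈?_ _≟_ x ys
  ... | no x∉ys = x , here refl , x∉ys
  ... | yes x∈ys with ∃∉-of-shorter _≟_ xs-unique ys─x<xs
    where
    ys─x<xs : length (ys ─ x∈ys) < length xs
    ys─x<xs = subst (_≤ length xs) (length-removeAt′ ys (index x∈ys)) (s≤s⁻¹ ys<x∷xs)
  ...   | z , z∈xs , z∉ys─x =
          z , there z∈xs , λ z∈ys → z∉ys─x (∈-─⁺ x∈ys z∈ys λ { refl → lookup x≢xs z∈xs refl })

  ∈-filterᵇ⁺ : ∀ {p : A → Bool} {x xs} → x ∈ xs → p x ≡ true → x ∈ filterᵇ p xs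
  ∈-filterᵇ⁺ {p} x∈xs px = ∈-filter⁺ (T? ∘ p) x∈xs (Equivalence.from T-≡ px)

  ≤-foldr-⊔-map : ∀ (f : A → ℕ) {x xs} → x ∈ xs → f x ≤ foldr _⊔_ 0 (map f xs)
  ≤-foldr-⊔-map f {xs = y ∷ ys} (here refl) = m≤m⊔n (f y) _
  ≤-foldr-⊔-map f {xs = y ∷ ys} (there x∈) = ≤-trans (≤-foldr-⊔-map f x∈) (m≤n⊔m (f y) _)

ProperListColouring : ∀ {n} → Rel (Fin n) 0ℓ → (Fin n → List ℕ) → Set
ProperListColouring {n} _#_ L =
  Σ (Fin n → ℕ) λ c → (∀ v → c v ∈ L v) × (∀ {u v} → u ≢ v → u # v → c u ≢ c v)

module GreedyColouring {n : ℕ} (_#_ : Rel (Fin n) 0ℓ) (#-sym : Symmetric _#_)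
  (L : Fin n → List ℕ) (L-unique : ∀ i → Unique (L i))
  (blockers : Fin n → List (Fin n))
  (blockers-cover : ∀ {i j} → toℕ j < toℕ i → i # j → j ∈ blockers i)
  (blockers-short : ∀ i → length (blockers i) < length (L i)) where

  ColouredBelow : ℕ → (Fin n → ℕ) → Set
  ColouredBelow k c =
    (∀ i → toℕ i < k → c i ∈ L i) ×
    (∀ {i j} → toℕ i < k → toℕ j < k → i ≢ j → i # j → c i ≢ c j)

  extend : ∀ {k} (k<n : k < n) {c} → ColouredBelow k c → ∃[ c′ ] ColouredBelow (suc k) c′
  extend {k} k<n {c} (c∈L , c-proper) = c′ , c′∈L , c′-proper
    where
    new : Fin n
    new = fromℕ< k<n

    free : ∃[ y ] y ∈ L new × y ∉ map c (blockers new)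
    free = ∃∉-of-shorter _≟_ (L-unique new)
             (subst (_< length (L new)) (sym (length-map c (blockers new))) (blockers-short new))

    y : ℕ
    y = proj₁ free

    c′ : Fin n → ℕ
    c′ = updateAt c new (const y)

    new-or-old : ∀ {i} → toℕ i < suc k → i ≡ new ⊎ toℕ i < k
    new-or-old i<1+k with m<1+n⇒m<n∨m≡n i<1+k
    ... | inj₁ i<k  = inj₂ i<k
    ... | inj₂ refl = inj₁ (toℕ-injective (sym (toℕ-fromℕ< k<n)))

    c′-new : c′ new ≡ y
    c′-new = updateAt-updates new c

    c′-old : ∀ {i} → toℕ i < k → c′ i ≡ c i
    c′-old {i} i<k = updateAt-minimal i new c λ { refl → <-irrefl (toℕ-fromℕ< k<n) i<k }

    y≢old : ∀ {j} → toℕ j < k → new # j → y ≢ c j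
    y≢old {j} j<k new#j y≡cj = proj₂ (proj₂ free) (subst (_∈ map c (blockers new)) (sym y≡cj)
      (∈-map⁺ c (blockers-cover (subst (toℕ j <_) (sym (toℕ-fromℕ< k<n)) j<k) new#j)))

    c′∈L : ∀ i → toℕ i < suc k → c′ i ∈ L i
    c′∈L i i<1+k with new-or-old i<1+k
    ... | inj₁ refl = subst (_∈ L new) (sym c′-new) (proj₁ (proj₂ free))
    ... | inj₂ i<k  = subst (_∈ L i) (sym (c′-old i<k)) (c∈L i i<k)

    c′-proper : ∀ {i j} → toℕ i < suc k → toℕ j < suc k → i ≢ j → i # j → c′ i ≢ c′ j
    c′-proper i<1+k j<1+k i≢j i#j c′i≡c′j with new-or-old i<1+k | new-or-old j<1+k
    ... | inj₁ refl | inj₁ refl = i≢j refl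
    ... | inj₁ refl | inj₂ j<k  =
      y≢old j<k i#j (trans (sym c′-new) (trans c′i≡c′j (c′-old j<k)))
    ... | inj₂ i<k  | inj₁ refl =
      y≢old i<k (#-sym i#j) (trans (sym c′-new) (trans (sym c′i≡c′j) (c′-old i<k)))
    ... | inj₂ i<k  | inj₂ j<k  =
      c-proper i<k j<k i≢j i#j (trans (sym (c′-old i<k)) (trans c′i≡c′j (c′-old j<k)))

  colouredBelow : ∀ k → k ≤ n → ∃[ c ] ColouredBelow k c
  colouredBelow 0       _   = const 0 , (λ _ ()) , λ ()
  colouredBelow (suc k) k<n = extend k<n (proj₂ (colouredBelow k (<⇒≤ k<n)))

  greedy-colouring : ProperListColouring _#_ L
  greedy-colouring with colouredBelow n (≤-reflexive refl)
  ... | c , c∈L , c-proper = c , (λ i → c∈L i (toℕ<n i)) , c-proper (toℕ<n _) (toℕ<n _)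

ProperListColouring-relabel : ∀ {n} {_#_ : Rel (Fin n) 0ℓ} {L} (σ : Permutation′ n) →
  ProperListColouring (λ i j → (σ ⟨$⟩ʳ i) # (σ ⟨$⟩ʳ j)) (L ∘ (σ ⟨$⟩ʳ_)) →
  ProperListColouring _#_ L
ProperListColouring-relabel {_#_ = _#_} {L} σ (c , c∈L , c-proper) =
  c ∘ (σ ⟨$⟩ˡ_) ,
  (λ v → subst (λ w → c (σ ⟨$⟩ˡ v) ∈ L w) (inverseʳ σ) (c∈L (σ ⟨$⟩ˡ v))) ,
  λ u≢v u#v → c-proper (u≢v ∘ ⟨$⟩ˡ-injective) (subst₂ _#_ (sym (inverseʳ σ)) (sym (inverseʳ σ)) u#v)
  where
  ⟨$⟩ˡ-injective : ∀ {u v} → σ ⟨$⟩ˡ u ≡ σ ⟨$⟩ˡ v → u ≡ v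
  ⟨$⟩ˡ-injective eq = trans (sym (inverseʳ σ)) (trans (cong (σ ⟨$⟩ʳ_) eq) (inverseʳ σ))

module _ {n} {G : Graph n} (S : SigmaSystem G) where

  SharesΣ : Rel (Fin n) 0ℓ
  SharesΣ u v = ∃[ t ] mem S t u ≡ true × mem S t v ≡ true

  Conflict : Rel (Fin n) 0ℓ
  Conflict u v = adj G u v ≡ true ⊎ SharesΣ u v

  Conflict-sym : Symmetric Conflict
  Conflict-sym (inj₁ uv-adj)         = inj₁ (adj-sym G _ _ uv-adj)
  Conflict-sym (inj₂ (t , u∈ , v∈)) = inj₂ (t , v∈ , u∈)

  adj⇒≢ : ∀ {u v} → adj G u v ≡ true → u ≢ v
  adj⇒≢ {u} uv-adj refl with trans (sym uv-adj) (adj-irrefl G u)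
  ... | ()

  IsΣColouring-of-conflictFree : ∀ {c} → (∀ {u v} → u ≢ v → Conflict u v → c u ≢ c v) →
                                 IsΣColouring S c
  IsΣColouring-of-conflictFree c-proper =
    (λ u v uv-adj → c-proper (adj⇒≢ uv-adj) (inj₁ uv-adj)) ,
    λ t u v u≢v u∈ v∈ → c-proper u≢v (inj₂ (t , u∈ , v∈))

  |Σ|≤ΔΣ : ∀ t → count (mem S t) ≤ ΔΣ S
  |Σ|≤ΔΣ t = ≤-foldr-⊔-map (λ v → count (mem S v)) (∈-allFin t)

  sharesΣ-cover : PairwiseDisjoint S → ∀ u →
                  ∃[ P ] length P ≤ ΔΣ S × (∀ {v} → SharesΣ u v → v ∈ P)
  sharesΣ-cover disjoint u with any? (λ t → mem S t u ≟ᵇ true)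
  ... | no u∉⋃Σ = [] , z≤n , λ (t , u∈Σt , _) → ⊥-elim (u∉⋃Σ (t , u∈Σt))
  ... | yes (t₀ , u∈Σt₀) = filterᵇ (mem S t₀) (allFin n) , |Σ|≤ΔΣ t₀ , covered
    where
    covered : ∀ {v} → SharesΣ u v → v ∈ filterᵇ (mem S t₀) (allFin n)
    covered {v} (t , u∈Σt , v∈Σt) with t Fin.≟ t₀
    ... | yes refl = ∈-filterᵇ⁺ (∈-allFin v) v∈Σt
    ... | no t≢t₀ with trans (sym u∈Σt₀) (disjoint t t₀ u t≢t₀ u∈Σt)
    ...   | ()

earlierNeighbours : ∀ {n} → Graph n → Permutation′ n → Fin n → List (Fin n)
earlierNeighbours {n} G σ i =
  filterᵇ (λ j → ⌊ j <? i ⌋ ∧ adj G (σ ⟨$⟩ʳ i) (σ ⟨$⟩ʳ j)) (allFin n)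

chooseΣ-of-degenerate : ∀ {n q} {G : Graph n} (S : SigmaSystem G) → PairwiseDisjoint S →
                        Degenerate q G → ChooseΣ≤ S (ΔΣ S + suc q)
chooseΣ-of-degenerate {n} {q} {G} S disjoint (σ , back-degree≤q) L L-unique L-long =
  let c , c∈L , c-proper = ProperListColouring-relabel σ
        (GreedyColouring.greedy-colouring _#_ (Conflict-sym S) (L ∘ π) (L-unique ∘ π)
           blockers blockers-cover blockers-short)
  in c , c∈L , IsΣColouring-of-conflictFree S c-proper
  where
  π : Fin n → Fin n
  π = σ ⟨$⟩ʳ_

  _#_ : Rel (Fin n) 0ℓ
  i # j = Conflict S (π i) (π j)

  partners : Fin n → List (Fin n)
  partners i = proj₁ (sharesΣ-cover S disjoint (π i))

  blockers : Fin n → List (Fin n)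
  blockers i = earlierNeighbours G σ i ++ map (σ ⟨$⟩ˡ_) (partners i)

  blockers-cover : ∀ {i j} → toℕ j < toℕ i → i # j → j ∈ blockers i
  blockers-cover {i} {j} j<i (inj₁ ij-adj) =
    ∈-++⁺ˡ (∈-filterᵇ⁺ {p = λ k → ⌊ k <? i ⌋ ∧ adj G (π i) (π k)} (∈-allFin j)
                       (cong₂ _∧_ (Equivalence.to T-≡ (fromWitness j<i)) ij-adj))
  blockers-cover {i} {j} _ (inj₂ shares) =
    ∈-++⁺ʳ (earlierNeighbours G σ i) (subst (_∈ map (σ ⟨$⟩ˡ_) (partners i)) (inverseˡ σ)
      (∈-map⁺ (σ ⟨$⟩ˡ_) (proj₂ (proj₂ (sharesΣ-cover S disjoint (π i))) shares)))

  blockers-short : ∀ i → length (blockers i) < length (L (π i))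
  blockers-short i = begin-strict
    length (blockers i)
      ≡⟨ length-++ (earlierNeighbours G σ i) ⟩
    length (earlierNeighbours G σ i) + length (map (σ ⟨$⟩ˡ_) (partners i))
      ≡⟨ cong (length (earlierNeighbours G σ i) +_) (length-map (σ ⟨$⟩ˡ_) (partners i)) ⟩
    length (earlierNeighbours G σ i) + length (partners i)
      ≤⟨ +-mono-≤ (back-degree≤q i) (proj₁ (proj₂ (sharesΣ-cover S disjoint (π i)))) ⟩
    q + ΔΣ S
      <⟨ n<1+n (q + ΔΣ S) ⟩
    suc (q + ΔΣ S)
      ≡⟨ cong suc (+-comm q (ΔΣ S)) ⟩
    suc (ΔΣ S + q)
      ≡⟨ +-suc (ΔΣ S) q ⟨
    ΔΣ S + suc q
      ≤⟨ L-long (π i) ⟩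
    length (L (π i)) ∎
    where open ≤-Reasoning

proposition5p1 : (𝓕 : GraphClass) → DegenerateClass 𝓕 →
    Σ ℕ λ c → ∀ (n : ℕ) (G : Graph n) → 𝓕 n G →
      (S : SigmaSystem G) → PairwiseDisjoint S →
      ChooseΣ≤ S (ΔΣ S + c)
proposition5p1 𝓕 (q , 𝓕-degenerate) =
  suc q , λ n G G∈𝓕 S disjoint → chooseΣ-of-degenerate S disjoint (𝓕-degenerate n G G∈𝓕)
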